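{- Let $u\le w$ in the Bruhat order of $S_n$. If the Postnikov--Stanley polynomial $D_u^w$ has the single chain Newton polytope (SCNP) property, then $D_u^w$ has saturated Newton polytope (SNP).
   Context: $S_n$ is the symmetric group on $[n]$; $\ell(w)$ is the number of inversions of $w$ (pairs $a<b$ with $w(a)>w(b)$). For $a<b$, $wt_{ab}$ swaps entries of $w$ in positions $a,b$. Bruhat covers: $u\lessdot v$ iff $v=ut_{ab}$ ($a<b$) and $\ell(v)=\ell(u)+1$; the Bruhat order is the transitive-reflexive closure. Edge weight $m(u\lessdot ut_{ab})=x_a+\dots+x_{b-1}$; a saturated chain $C=(u_0\lessdot\cdots\lessdot u_k)$ has weight $m_C=\prod_i m(u_{i-1}\lessdot u_i)$. The Postnikov--Stanley polynomial is $D_u^w=\frac{1}{(\ell(w)-\ell(u))!}\sum_C m_C$, summed over saturated chains $C$ from $u$ to $w$. The support of a polynomial is its set of exponent vectors with nonzero coefficient; the Newton polytope is the convex hull of the support; a polynomial has SNP if its support equals the set of all integer points of its Newton polytope. $D_u^w$ has SCNP if there exists a saturated chain $C$ from $u$ to $w$ with $\mathrm{supp}(m_C)=\mathrm{supp}(D_u^w)$. -}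

module Defs where

open import Data.Nat as ℕ using (ℕ; zero; suc; _!)
open import Data.Nat.Properties using (_!≢0)
import Data.Nat.Properties as ℕP
open import Data.Integer as ℤ using (ℤ; +_)
open import Data.Rational as ℚ using (ℚ; 0ℚ; 1ℚ)
import Data.Rational.Properties as ℚP
open import Data.Fin as Fin using (Fin; toℕ)
import Data.Fin.Properties as FinP
open import Data.Vec as Vec using (Vec; lookup; _[_]≔_; tabulate; zipWith; replicate)
import Data.Vec.Properties as VecP
open import Data.List as List using (List; []; _∷_; _++_; concatMap; filter; allFin; length)
open import Data.List.Relation.Unary.All using (All)
open import Data.Product using (Σ; _×_; _,_; proj₁; proj₂; ∃)
open import Relation.Nullary using (¬_; yes; no; Dec)
open import Relation.Nullary.Decidable using (_×-dec_)
open import Relation.Binary.PropositionalEquality using (_≡_)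
open import Relation.Binary.Construct.Closure.ReflexiveTransitive using (Star; ε; _◅_)
open import Function.Bundles using (_⇔_)

-- Polynomials in x_1..x_n over ℚ, as finite formal sums of terms
-- (coefficient, exponent vector); the polynomial is determined by
-- the coefficient function 'coeff'.

sumℚ : List ℚ → ℚ
sumℚ = List.foldr ℚ._+_ 0ℚ

Exp : ℕ → Set
Exp n = Vec ℕ n

Poly : ℕ → Set
Poly n = List (ℚ × Exp n)

module _ {n : ℕ} where

  pconst : ℚ → Poly n
  pconst c = (c , replicate n 0) ∷ []

  pvar : Fin n → Poly n
  pvar i = (1ℚ , tabulate (λ j → unitAt j)) ∷ []
    where
    unitAt : Fin n → ℕ
    unitAt j with i Fin.≟ j
    ... | yes _ = 1
    ... | no  _ = 0

  _⊕_ : Poly n → Poly n → Poly n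
  p ⊕ q = p ++ q

  _⊗_ : Poly n → Poly n → Poly n
  p ⊗ q = concatMap (λ t → List.map (λ s → (proj₁ t ℚ.* proj₁ s , zipWith ℕ._+_ (proj₂ t) (proj₂ s))) q) p

  pscale : ℚ → Poly n → Poly n
  pscale c p = pconst c ⊗ p

  coeff : Poly n → Exp n → ℚ
  coeff [] e = 0ℚ
  coeff ((c , f) ∷ p) e with VecP.≡-dec ℕP._≟_ f e
  ... | yes _ = c ℚ.+ coeff p e
  ... | no  _ = coeff p e

  InSupp : Poly n → Exp n → Set
  InSupp p e = ¬ (coeff p e ≡ 0ℚ)

  -- The integer point a ∈ ℤ^n lies in the Newton polytope of p
  -- (convex hull of the support), witnessed by a (rational) convex combination
  -- of support points.
  InNewton : Poly n → Vec ℤ n → Set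
  InNewton p a =
    Σ (List (ℚ × Exp n)) λ ws →
      All (λ w → (0ℚ ℚ.≤ proj₁ w) × InSupp p (proj₂ w)) ws ×
      (sumℚ (List.map proj₁ ws) ≡ 1ℚ) ×
      (∀ (i : Fin n) →
         sumℚ (List.map (λ w → proj₁ w ℚ.* (+ lookup (proj₂ w) i ℚ./ 1)) ws)
           ≡ (lookup a i ℚ./ 1))

  toℤ : Exp n → Vec ℤ n
  toℤ = Vec.map +_

  SNP : Poly n → Set
  SNP p = (∀ e → InSupp p e → InNewton p (toℤ e)) ×
          (∀ a → InNewton p a → Σ (Exp n) λ e → (toℤ e ≡ a) × InSupp p e)

  SameSupp : Poly n → Poly n → Set
  SameSupp p q = ∀ e → InSupp p e ⇔ InSupp q e

-- Permutations of [n] in one-line notation (positions and values in Fin n).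

Perm : ℕ → Set
Perm n = Vec (Fin n) n

module _ {n : ℕ} where

  IsPerm : Perm n → Set
  IsPerm w = ∀ i j → lookup w i ≡ lookup w j → i ≡ j

  pairs : List (Fin n × Fin n)
  pairs = concatMap (λ a → List.map (λ b → (a , b)) (allFin n)) (allFin n)

  ltPairs : List (Fin n × Fin n)
  ltPairs = filter (λ ab → proj₁ ab Fin.<? proj₂ ab) pairs

  len : Perm n → ℕ
  len w = length (filter (λ ab → lookup w (proj₂ ab) Fin.<? lookup w (proj₁ ab)) ltPairs)

  swap : Perm n → Fin n → Fin n → Perm n
  swap w a b = (w [ a ]≔ lookup w b) [ b ]≔ lookup w a

  record Cover (u v : Perm n) : Set where
    constructor cover
    field
      a b   : Fin n
      a<b   : a Fin.< b
      isSwp : v ≡ swap u a b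
      lenUp : len v ≡ suc (len u)

  Bruhat : Perm n → Perm n → Set
  Bruhat = Star Cover

  SatChain : Perm n → Perm n → Set
  SatChain = Star Cover

  edgeWt : Fin n → Fin n → Poly n
  edgeWt a b = concatMap pvar
    (filter (λ i → (toℕ a ℕ.≤? toℕ i) ×-dec (toℕ i ℕ.<? toℕ b)) (allFin n))

  chainWt : ∀ {u w} → SatChain u w → Poly n
  chainWt ε = pconst 1ℚ
  chainWt (cover a b _ _ _ ◅ C) = edgeWt a b ⊗ chainWt C

  chainSum : ℕ → Perm n → Perm n → Poly n
  chainSum zero u w with VecP.≡-dec Fin._≟_ u w
  ... | yes _ = pconst 1ℚ
  ... | no  _ = []
  chainSum (suc k) u w =
    concatMap (λ ab → step ab (len (swap u (proj₁ ab) (proj₂ ab)) ℕ.≟ suc (len u))) ltPairs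
    where
    step : (ab : Fin n × Fin n) → Dec (len (swap u (proj₁ ab) (proj₂ ab)) ≡ suc (len u)) → Poly n
    step (a , b) (yes _) = edgeWt a b ⊗ chainSum k (swap u a b) w
    step (a , b) (no  _) = []

  -- Postnikov–Stanley polynomial D_u^w
  -- (all saturated chains from u to w have length ℓ(w) - ℓ(u))
  D : Perm n → Perm n → Poly n
  D u w = pscale ((+ 1) ℚ./ (k !)) (chainSum k u w)
    where
    k = len w ℕ.∸ len u
    instance _ = k !≢0

  SCNP : Perm n → Perm n → Set
  SCNP u w = Σ (SatChain u w) λ C → SameSupp (chainWt C) (D u w)

-- By SCNP the support of D u w is the support of a single chain weight
-- m_C = ∏ (x_a + ... + x_{b-1}), i.e. the set of exponent vectors obtained by
-- choosing one position in each interval [a, b) of the chain.  Such a choice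
-- exists exactly when Hall's condition for intervals holds: the total degree is
-- at most the number of intervals, and every window [c, d) carries at least as
-- much mass as there are intervals inside it.  Sufficiency is the greedy
-- argument: mass at the first position goes to the interval through it that
-- ends first.  The conditions are linear inequalities, so they survive convex
-- combinations; hence every integer point of the Newton polytope (necessarily
-- nonnegative) satisfies them and is itself an exponent of D u w.

module Submission where

open import Defs
open import Algebra.Bundles using (CommutativeMonoid)
open import Data.Bool using (true; false)
open import Data.Empty using (⊥-elim)
open import Data.Fin as Fin using (Fin; toℕ)
import Data.Fin.Properties as FinP
open import Data.Integer as ℤ using (ℤ; +_; -[1+_])
import Data.Integer.Properties as ℤP
open import Data.List as List
  using (List; []; _∷_; map; _++_; filter; length; allFin; concatMap; cartesianProductWith)
import Data.List.Properties as ListP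
open import Data.List.Relation.Unary.All as All using (All; []; _∷_)
import Data.List.Relation.Unary.All.Properties as AllP
open import Data.List.Relation.Unary.Any as Any using (Any; here; there; _─_)
open import Data.List.Membership.Propositional using (_∈_; _∉_; find)
import Data.List.Membership.Propositional.Properties as ∈P
open import Data.Nat as ℕ using (ℕ; zero; suc; pred; _+_; _≤_; _<_; _≤?_; _<?_; _≟_; z≤n; s≤s)
import Data.Nat.Coprimality as Coprime
import Data.Nat.Properties as ℕP
open import Data.List.Extrema ℕP.≤-totalOrder using (argmin; argmin-all; f[argmin]≤f[xs])
open import Data.Product as Product using (Σ; ∃; _×_; _,_; proj₁; proj₂)
open import Data.Rational as ℚ using (ℚ; 0ℚ; 1ℚ; mkℚ; _/_)
import Data.Rational.Properties as ℚP
open import Data.Vec as Vec using (Vec; []; _∷_; head; tail; lookup; replicate; tabulate; zipWith; _[_]≔_)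
import Data.Vec.Properties as VecP
open import Function using (_∘_; _⇔_; mk⇔; Equivalence)
open import Function.Construct.Composition using (_⇔-∘_)
open import Function.Construct.Symmetry using (⇔-sym)
open import Level using (0ℓ)
open import Relation.Binary.Construct.Closure.ReflexiveTransitive using (ε; _◅_)
open import Relation.Binary.PropositionalEquality
open import Relation.Nullary using (Dec; yes; no; does; ¬_)
open import Relation.Nullary.Decidable using (_×-dec_; decidable-stable)
open import Relation.Unary using (Pred; Decidable)

open import Algebra.Properties.CommutativeSemigroup ℕP.+-commutativeSemigroup
  using (interchange; x∙yz≈y∙xz)
open import Algebra.Properties.CommutativeSemigroup
  (CommutativeMonoid.commutativeSemigroup ℚP.+-0-commutativeMonoid)
  using () renaming (interchange to ℚ-interchange)

private
  variable
    A B : Set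

-- Natural numbers in ℚ and weighted sums

ι : ℕ → ℚ
ι k = + k / 1

/1≡mkℚ : ∀ z → z / 1 ≡ mkℚ z 0 (Coprime.sym (Coprime.1-coprimeTo ℤ.∣ z ∣))
/1≡mkℚ z = ℚP.↥p/↧p≡p (mkℚ z 0 _)

ι-mono-≤ : ∀ {m k} → m ≤ k → ι m ℚ.≤ ι k
ι-mono-≤ {m} {k} m≤k rewrite /1≡mkℚ (+ m) | /1≡mkℚ (+ k) =
  ℚ.*≤* (subst₂ ℤ._≤_ (sym (ℤP.*-identityʳ (+ m))) (sym (ℤP.*-identityʳ (+ k))) (ℤ.+≤+ m≤k))

ι-cancel-≤ : ∀ {m k} → ι m ℚ.≤ ι k → m ≤ k
ι-cancel-≤ {m} {k} ιm≤ιk rewrite /1≡mkℚ (+ m) | /1≡mkℚ (+ k) =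
  ℤP.drop‿+≤+ (subst₂ ℤ._≤_ (ℤP.*-identityʳ (+ m)) (ℤP.*-identityʳ (+ k)) (ℚP.drop-*≤* ιm≤ιk))

ι-homo-+ : ∀ m k → ι (m ℕ.+ k) ≡ ι m ℚ.+ ι k
ι-homo-+ m k = begin
  + (m ℕ.+ k) / 1                         ≡⟨ cong (_/ 1) numerators ⟩
  (+ m ℤ.* + 1 ℤ.+ + k ℤ.* + 1) / 1       ≡⟨ cong₂ ℚ._+_ (/1≡mkℚ (+ m)) (/1≡mkℚ (+ k)) ⟨
  ι m ℚ.+ ι k                             ∎
  where
  open ≡-Reasoning
  numerators : + (m ℕ.+ k) ≡ + m ℤ.* + 1 ℤ.+ + k ℤ.* + 1
  numerators = trans (ℤP.pos-+ m k) (sym (cong₂ ℤ._+_ (ℤP.*-identityʳ (+ m)) (ℤP.*-identityʳ (+ k))))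

nonNegative-/1 : ∀ z → 0ℚ ℚ.≤ z / 1 → ∃ λ k → z ≡ + k
nonNegative-/1 z 0≤z rewrite /1≡mkℚ z with z | ℚP.drop-*≤* 0≤z
... | + k      | _  = k , refl
... | -[1+ _ ] | ()

-- InNewton's coordinate sums are, definitionally, weightedSum ws (λ f → ι (lookup f i)).
weightedSum : List (ℚ × A) → (A → ℚ) → ℚ
weightedSum ws h = sumℚ (map (λ w → proj₁ w ℚ.* h (proj₂ w)) ws)

weightedSum-+ : ∀ (ws : List (ℚ × A)) (g h : A → ℚ) →
                weightedSum ws (λ a → g a ℚ.+ h a) ≡ weightedSum ws g ℚ.+ weightedSum ws h
weightedSum-+ []             g h = refl
weightedSum-+ ((r , a) ∷ ws) g h = begin
  r ℚ.* (g a ℚ.+ h a) ℚ.+ weightedSum ws (λ a → g a ℚ.+ h a)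
    ≡⟨ cong₂ ℚ._+_ (ℚP.*-distribˡ-+ r (g a) (h a)) (weightedSum-+ ws g h) ⟩
  (r ℚ.* g a ℚ.+ r ℚ.* h a) ℚ.+ (weightedSum ws g ℚ.+ weightedSum ws h)
    ≡⟨ ℚ-interchange (r ℚ.* g a) (r ℚ.* h a) (weightedSum ws g) (weightedSum ws h) ⟩
  weightedSum ((r , a) ∷ ws) g ℚ.+ weightedSum ((r , a) ∷ ws) h ∎
  where open ≡-Reasoning

weightedSum-const : ∀ (ws : List (ℚ × A)) r → weightedSum ws (λ _ → r) ≡ sumℚ (map proj₁ ws) ℚ.* r
weightedSum-const []              r = sym (ℚP.*-zeroˡ r)
weightedSum-const ((s , _) ∷ ws)  r =
  trans (cong (s ℚ.* r ℚ.+_) (weightedSum-const ws r)) (sym (ℚP.*-distribʳ-+ r s _))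

weightedSum-zero : ∀ (ws : List (ℚ × A)) → weightedSum ws (λ _ → 0ℚ) ≡ 0ℚ
weightedSum-zero ws = trans (weightedSum-const ws 0ℚ) (ℚP.*-zeroʳ (sumℚ (map proj₁ ws)))

weightedSum-mono-≤ : ∀ {ws : List (ℚ × A)} {g h : A → ℚ} → All (λ w → 0ℚ ℚ.≤ proj₁ w) ws →
                     All (λ w → g (proj₂ w) ℚ.≤ h (proj₂ w)) ws →
                     weightedSum ws g ℚ.≤ weightedSum ws h
weightedSum-mono-≤ []         []         = ℚP.≤-refl
weightedSum-mono-≤ {ws = (r , _) ∷ _} (0≤r ∷ ps) (g≤h ∷ qs) =
  ℚP.+-mono-≤ (ℚP.*-monoˡ-≤-nonNeg r {{ℚ.nonNegative 0≤r}} g≤h) (weightedSum-mono-≤ ps qs)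

weightedSum-map₂ : ∀ (ws : List (ℚ × A)) (f : A → B) (h : B → ℚ) →
                   weightedSum (map (Product.map₂ f) ws) h ≡ weightedSum ws (h ∘ f)
weightedSum-map₂ []             f h = refl
weightedSum-map₂ ((r , a) ∷ ws) f h = cong (r ℚ.* h (f a) ℚ.+_) (weightedSum-map₂ ws f h)

weightedSum-cong : ∀ (ws : List (ℚ × A)) {g h : A → ℚ} → (∀ a → g a ≡ h a) →
                   weightedSum ws g ≡ weightedSum ws h
weightedSum-cong ws g≗h = cong sumℚ (ListP.map-cong (λ w → cong (proj₁ w ℚ.*_) (g≗h (proj₂ w))) ws)

weightedSum-const-convex : ∀ (ws : List (ℚ × A)) r → sumℚ (map proj₁ ws) ≡ 1ℚ →
                           weightedSum ws (λ _ → r) ≡ r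
weightedSum-const-convex ws r total =
  trans (weightedSum-const ws r) (trans (cong (ℚ._* r) total) (ℚP.*-identityˡ r))

weightedSum-nonNeg : ∀ {ws : List (ℚ × A)} {h : A → ℚ} → All (λ w → 0ℚ ℚ.≤ proj₁ w) ws →
                     All (λ w → 0ℚ ℚ.≤ h (proj₂ w)) ws → 0ℚ ℚ.≤ weightedSum ws h
weightedSum-nonNeg {ws = ws} {h} nonNeg h≥0 =
  subst (ℚ._≤ weightedSum ws h) (weightedSum-zero ws) (weightedSum-mono-≤ nonNeg h≥0)

-- Interval families, selections and Hall's condition

-- (a , b) is the half-open range [a, b) of 0-based positions, so that edgeWt a b
-- is the sum of the variables at the positions of (toℕ a , toℕ b), and
-- windowSum (c , d) e = e_c + ... + e_{d-1}.
Interval : Set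
Interval = ℕ × ℕ

_∈ᵢ_ : ℕ → Interval → Set
k ∈ᵢ (a , b) = a ≤ k × k < b

_∈ᵢ?_ : (k : ℕ) (I : Interval) → Dec (k ∈ᵢ I)
k ∈ᵢ? (a , b) = (a ≤? k) ×-dec (k <? b)

_⊑_ : Interval → Interval → Set
(a , b) ⊑ (c , d) = c ≤ a × b ≤ d

_⊑?_ : (I J : Interval) → Dec (I ⊑ J)
(a , b) ⊑? (c , d) = (c ≤? a) ×-dec (b ≤? d)

⊑-refl : ∀ I → I ⊑ I
⊑-refl _ = ℕP.≤-refl , ℕP.≤-refl

∈ᵢ-⊑ : ∀ {k I J} → k ∈ᵢ I → I ⊑ J → k ∈ᵢ J
∈ᵢ-⊑ (a≤k , k<b) (c≤a , b≤d) = ℕP.≤-trans c≤a a≤k , ℕP.<-≤-trans k<b b≤d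

shift : Interval → Interval
shift (a , b) = pred a , pred b

unshift-∈ᵢ : ∀ I {k} → k ∈ᵢ shift I → suc k ∈ᵢ I
unshift-∈ᵢ (zero  , suc b) (_   , k<b) = z≤n , s≤s k<b
unshift-∈ᵢ (suc a , suc b) (a≤k , k<b) = s≤s a≤k , s≤s k<b
unshift-∈ᵢ (_     , zero)  (_   , ())

Bounded : ℕ → List Interval → Set
Bounded m = All (λ I → proj₂ I ≤ m)

infixl 6 _⊞_

_⊞_ : ∀ {m} → Exp m → Exp m → Exp m
_⊞_ = zipWith _+_

⊞-identityˡ : ∀ {m} (e : Exp m) → replicate m 0 ⊞ e ≡ e
⊞-identityˡ = VecP.zipWith-identityˡ ℕP.+-identityˡ

⊞-swap : ∀ {m} (u v e : Exp m) → u ⊞ (v ⊞ e) ≡ v ⊞ (u ⊞ e)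
⊞-swap []      []      []      = refl
⊞-swap (x ∷ u) (y ∷ v) (z ∷ e) = cong₂ _∷_ (x∙yz≈y∙xz x y z) (⊞-swap u v e)

unit : ∀ {m} → Fin m → Exp m
unit i = replicate _ 0 [ i ]≔ 1

windowSum : ∀ {m} → Interval → Exp m → ℕ
windowSum {zero}  _               _ = 0
windowSum {suc m} (zero  , zero)  _ = 0
windowSum {suc m} (zero  , suc d) e = head e + windowSum (zero , d) (tail e)
windowSum {suc m} (suc c , d)     e = windowSum (c , pred d) (tail e)

windowSum-⊞ : ∀ {m} J (u v : Exp m) → windowSum J (u ⊞ v) ≡ windowSum J u + windowSum J v
windowSum-⊞ {zero}  _               _       _       = refl
windowSum-⊞ {suc m} (zero  , zero)  _       _       = refl
windowSum-⊞ {suc m} (zero  , suc d) (x ∷ u) (y ∷ v) =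
  trans (cong (λ s → x + y + s) (windowSum-⊞ (zero , d) u v)) (interchange x y _ _)
windowSum-⊞ {suc m} (suc c , d)     (x ∷ u) (y ∷ v) = windowSum-⊞ (c , pred d) u v

windowSum-zeros : ∀ {m} J → windowSum J (replicate m 0) ≡ 0
windowSum-zeros {zero}  _               = refl
windowSum-zeros {suc m} (zero  , zero)  = refl
windowSum-zeros {suc m} (zero  , suc d) = windowSum-zeros {m} (zero , d)
windowSum-zeros {suc m} (suc c , d)     = windowSum-zeros {m} (c , pred d)

windowSum-unit-≤ : ∀ {m} J (i : Fin m) → windowSum J (unit i) ≤ 1
windowSum-unit-≤ {suc m} (zero  , zero)  _           = z≤n
windowSum-unit-≤ {suc m} (zero  , suc d) Fin.zero    = s≤s (ℕP.≤-reflexive (windowSum-zeros {m} (zero , d)))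
windowSum-unit-≤ {suc m} (zero  , suc d) (Fin.suc i) = windowSum-unit-≤ (zero , d) i
windowSum-unit-≤ {suc m} (suc c , d)     Fin.zero    =
  ℕP.≤-trans (ℕP.≤-reflexive (windowSum-zeros {m} (c , pred d))) z≤n
windowSum-unit-≤ {suc m} (suc c , d)     (Fin.suc i) = windowSum-unit-≤ (c , pred d) i

windowSum-unit-∈ : ∀ {m} J (i : Fin m) → toℕ i ∈ᵢ J → 1 ≤ windowSum J (unit i)
windowSum-unit-∈ {suc m} (zero  , suc d) Fin.zero    _                   = s≤s z≤n
windowSum-unit-∈ {suc m} (zero  , suc d) (Fin.suc i) (_       , s≤s i<d) =
  windowSum-unit-∈ (zero , d) i (z≤n , i<d)
windowSum-unit-∈ {suc m} (suc c , suc d) (Fin.suc i) (s≤s c≤i , s≤s i<d) =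
  windowSum-unit-∈ (c , d) i (c≤i , i<d)
windowSum-unit-∈ {suc m} (zero  , zero)  _           (_ , ())
windowSum-unit-∈ {suc m} (suc c , _)     Fin.zero    (() , _)
windowSum-unit-∈ {suc m} (suc c , zero)  (Fin.suc i) (_ , ())

data Selection {m : ℕ} : List Interval → Exp m → Set where
  []   : Selection [] (replicate m 0)
  pick : ∀ {I L e} (i : Fin m) → toℕ i ∈ᵢ I → Selection L e → Selection (I ∷ L) (unit i ⊞ e)

selection-insert : ∀ {m I L} {e : Exp m} {i} (I∈L : I ∈ L) → toℕ i ∈ᵢ I →
                   Selection (L ─ I∈L) e → Selection L (unit i ⊞ e)
selection-insert         (here refl)  i∈I s              = pick _ i∈I s
selection-insert {i = i} (there I∈L)  i∈I (pick j j∈J s) =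
  subst (Selection _) (⊞-swap (unit j) (unit i) _) (pick j j∈J (selection-insert I∈L i∈I s))

selection-unshift : ∀ {m} L {e : Exp m} → Selection (map shift L) e → Selection L (0 ∷ e)
selection-unshift []      []             = []
selection-unshift (I ∷ L) (pick i i∈I s) = pick (Fin.suc i) (unshift-∈ᵢ I i∈I) (selection-unshift L s)

count : {P : Pred A 0ℓ} → Decidable P → List A → ℕ
count P? xs = length (filter P? xs)

module _ {A : Set} {P : Pred A 0ℓ} (P? : Decidable P) where

  count-map : ∀ (f : B → A) xs → count P? (map f xs) ≡ count (P? ∘ f) xs
  count-map f []       = refl
  count-map f (x ∷ xs) with does (P? (f x))
  ... | true  = cong suc (count-map f xs)
  ... | false = count-map f xs

  count-─ : ∀ {x xs} (x∈xs : x ∈ xs) → count P? (x ∷ (xs ─ x∈xs)) ≡ count P? xs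
  count-─ (here refl) = refl
  count-─ {x} {y ∷ _} (there x∈xs) with ih ← count-─ x∈xs | does (P? x)
  ... | true with does (P? y)
  ...   | true  = cong suc ih
  ...   | false = ih
  count-─ {x} {y ∷ _} (there x∈xs) | false with does (P? y)
  ...   | true  = cong suc ih
  ...   | false = ih

  count-─-≤ : ∀ {x xs} (x∈xs : x ∈ xs) → count P? (xs ─ x∈xs) ≤ count P? xs
  count-─-≤ {x} x∈xs with eq ← count-─ x∈xs | does (P? x)
  ... | true  = ℕP.≤-trans (ℕP.n≤1+n _) (ℕP.≤-reflexive eq)
  ... | false = ℕP.≤-reflexive eq

  count-accept : ∀ {x xs} → P x → count P? (x ∷ xs) ≡ suc (count P? xs)
  count-accept px = cong length (ListP.filter-accept P? px)

  count-reject : ∀ {x xs} → ¬ P x → count P? (x ∷ xs) ≡ count P? xs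
  count-reject ¬px = cong length (ListP.filter-reject P? ¬px)

  count-─-accept : ∀ {x xs} (x∈xs : x ∈ xs) → P x → suc (count P? (xs ─ x∈xs)) ≡ count P? xs
  count-─-accept x∈xs px = trans (sym (count-accept px)) (count-─ x∈xs)

  count-all : ∀ {xs} → All P xs → count P? xs ≡ length xs
  count-all all = cong length (ListP.filter-all P? all)

  count-mono : ∀ {Q : Pred A 0ℓ} (Q? : Decidable Q) {xs} → All (λ x → P x → Q x) xs →
               count P? xs ≤ count Q? xs
  count-mono Q? []                     = z≤n
  count-mono Q? {x ∷ _} (P⇒Q ∷ P⇒Qs) with P? x | Q? x
  ... | yes _  | yes _  = s≤s (count-mono Q? P⇒Qs)
  ... | yes px | no ¬qx = ⊥-elim (¬qx (P⇒Q px))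
  ... | no _   | yes _  = ℕP.m≤n⇒m≤1+n (count-mono Q? P⇒Qs)
  ... | no _   | no _   = count-mono Q? P⇒Qs

record HallCondition {m} (L : List Interval) (e : Exp m) : Set where
  field
    total-≤  : windowSum (0 , m) e ≤ length L
    window-≥ : ∀ J → count (_⊑? J) L ≤ windowSum J e

open HallCondition

selection⇒hall : ∀ {m L} {e : Exp m} → Selection L e → HallCondition L e
selection⇒hall {m} [] = record
  { total-≤  = ℕP.≤-reflexive (windowSum-zeros {m} (0 , m))
  ; window-≥ = λ _ → z≤n
  }
selection⇒hall {m} (pick {I} {L} {e} i i∈I s) = record
  { total-≤  = begin
      windowSum (0 , m) (unit i ⊞ e)
        ≡⟨ windowSum-⊞ (0 , m) (unit i) e ⟩
      windowSum (0 , m) (unit i) + windowSum (0 , m) e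
        ≤⟨ ℕP.+-mono-≤ (windowSum-unit-≤ (0 , m) i) (total-≤ hall) ⟩
      suc (length L) ∎
  ; window-≥ = window
  }
  where
  open ℕP.≤-Reasoning
  hall : HallCondition L e
  hall = selection⇒hall s
  window : ∀ J → count (_⊑? J) (I ∷ L) ≤ windowSum J (unit i ⊞ e)
  window J with I ⊑? J
  ... | yes I⊑J = begin
    count (_⊑? J) (I ∷ L)                ≡⟨ count-accept (_⊑? J) I⊑J ⟩
    suc (count (_⊑? J) L)                ≤⟨ ℕP.+-mono-≤ (windowSum-unit-∈ J i (∈ᵢ-⊑ i∈I I⊑J))
                                                         (window-≥ hall J) ⟩
    windowSum J (unit i) + windowSum J e ≡⟨ windowSum-⊞ J (unit i) e ⟨
    windowSum J (unit i ⊞ e)             ∎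
  ... | no I⋢J = begin
    count (_⊑? J) (I ∷ L)                ≡⟨ count-reject (_⊑? J) I⋢J ⟩
    count (_⊑? J) L                      ≤⟨ ℕP.≤-trans (window-≥ hall J) (ℕP.m≤n+m _ _) ⟩
    windowSum J (unit i) + windowSum J e ≡⟨ windowSum-⊞ J (unit i) e ⟨
    windowSum J (unit i ⊞ e)             ∎

hall-occupied : ∀ {m L I} {e : Exp m} → HallCondition L e → I ∈ L → 1 ≤ windowSum I e
hall-occupied {I = I} hall I∈L =
  ℕP.≤-trans (ListP.filter-some (_⊑? I) (Any.map (λ { refl → ⊑-refl I }) I∈L)) (window-≥ hall I)

unshiftWindow : Interval → Interval
unshiftWindow (zero  , d) = zero , suc d
unshiftWindow (suc c , d) = suc (suc c) , suc d

pred≤⇒≤suc : ∀ b {d} → pred b ≤ d → b ≤ suc d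
pred≤⇒≤suc zero    _ = z≤n
pred≤⇒≤suc (suc b) h = s≤s h

shift-⊑ : ∀ I J → shift I ⊑ J → I ⊑ unshiftWindow J
shift-⊑ (a     , b) (zero  , d) (_   , b-1≤d) = z≤n , pred≤⇒≤suc b b-1≤d
shift-⊑ (suc a , b) (suc c , d) (c≤a , b-1≤d) = s≤s c≤a , pred≤⇒≤suc b b-1≤d
shift-⊑ (zero  , _) (suc _ , _) (() , _)

windowSum-unshiftWindow : ∀ {m} J (e : Exp m) → windowSum (unshiftWindow J) (0 ∷ e) ≡ windowSum J e
windowSum-unshiftWindow (zero  , d) e = refl
windowSum-unshiftWindow (suc c , d) e = refl

hall-shift : ∀ {m L} {e : Exp m} → HallCondition L (0 ∷ e) → HallCondition (map shift L) e
hall-shift {m} {L} {e} hall = record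
  { total-≤  = subst (windowSum (0 , m) e ≤_) (sym (ListP.length-map shift L)) (total-≤ hall)
  ; window-≥ = λ J → begin
      count (_⊑? J) (map shift L)            ≡⟨ count-map (_⊑? J) shift L ⟩
      count ((_⊑? J) ∘ shift) L              ≤⟨ count-mono ((_⊑? J) ∘ shift) (_⊑? unshiftWindow J) {L}
                                                             (All.tabulate λ {I} _ → shift-⊑ I J) ⟩
      count (_⊑? unshiftWindow J) L          ≤⟨ window-≥ hall (unshiftWindow J) ⟩
      windowSum (unshiftWindow J) (0 ∷ e)    ≡⟨ windowSum-unshiftWindow J e ⟩
      windowSum J e                          ∎
  }
  where open ℕP.≤-Reasoning

bounded-shift : ∀ {m L} → Bounded (suc m) L → Bounded m (map shift L)
bounded-shift = AllP.map⁺ ∘ All.map ℕP.pred-mono-≤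

hall-someStartsAtZero : ∀ {m L x} {e : Exp m} → Bounded (suc m) L → HallCondition L (suc x ∷ e) →
                        Any (λ I → proj₁ I ≡ 0) L
hall-someStartsAtZero {m} {L} {x} {e} bounded hall with Any.any? (λ I → proj₁ I ≟ 0) L
... | yes some = some
... | no  none = ⊥-elim (ℕP.<-irrefl refl (begin-strict
  length L                      ≡⟨ count-all (_⊑? (1 , suc m)) inside ⟨
  count (_⊑? (1 , suc m)) L     ≤⟨ window-≥ hall (1 , suc m) ⟩
  windowSum (0 , m) e           <⟨ s≤s (ℕP.m≤n+m _ x) ⟩
  suc x + windowSum (0 , m) e   ≤⟨ total-≤ hall ⟩
  length L                      ∎))
  where
  open ℕP.≤-Reasoning
  inside : All (_⊑ (1 , suc m)) L
  inside = All.zipWith (λ (b≤ , a≢0) → ℕP.n≢0⇒n>0 a≢0 , b≤) (bounded , AllP.¬Any⇒All¬ L none)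

earliestEndingFromZero : ∀ {L} → Any (λ I → proj₁ I ≡ 0) L →
                   ∃ λ I → (I ∈ L × proj₁ I ≡ 0) × (∀ {J} → J ∈ L → proj₁ J ≡ 0 → proj₂ I ≤ proj₂ J)
earliestEndingFromZero {L} some with find some
... | I₀ , I₀∈L , I₀-0 =
  argmin proj₂ I₀ L₀ ,
  argmin-all proj₂ (I₀∈L , I₀-0) (All.tabulate (∈P.∈-filter⁻ startsAtZero?)) ,
  λ J∈L J-0 → All.lookup (f[argmin]≤f[xs] I₀ L₀) (∈P.∈-filter⁺ startsAtZero? J∈L J-0)
  where
  startsAtZero? : (I : Interval) → Dec (proj₁ I ≡ 0)
  startsAtZero? I = proj₁ I ≟ 0
  L₀ : List Interval
  L₀ = filter startsAtZero? L

hall-─ : ∀ {m L I x} {e : Exp m} → HallCondition L (suc x ∷ e) → (I∈L : I ∈ L) →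
            (∀ {J} → J ∈ L → proj₁ J ≡ 0 → proj₂ I ≤ proj₂ J) → HallCondition (L ─ I∈L) (x ∷ e)
hall-─ {m} {L} {I} {x} {e} hall I∈L earliest = record
  { total-≤  = ℕP.≤-pred (subst (suc x + windowSum (0 , m) e ≤_)
                                (ListP.length-removeAt′ L (Any.index I∈L)) (total-≤ hall))
  ; window-≥ = window
  }
  where
  open ℕP.≤-Reasoning
  window : ∀ J → count (_⊑? J) (L ─ I∈L) ≤ windowSum J (x ∷ e)
  window (suc c , d)    = ℕP.≤-trans (count-─-≤ (_⊑? (suc c , d)) I∈L) (window-≥ hall (suc c , d))
  window (zero , zero)  = ℕP.≤-trans (count-─-≤ (_⊑? (0 , 0)) I∈L) (window-≥ hall (0 , 0))
  window (zero , suc d) with I ⊑? (0 , suc d)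
  ... | yes I⊑J = ℕP.≤-pred (begin
    suc (count (_⊑? (0 , suc d)) (L ─ I∈L)) ≡⟨ count-─-accept (_⊑? (0 , suc d)) I∈L I⊑J ⟩
    count (_⊑? (0 , suc d)) L               ≤⟨ window-≥ hall (0 , suc d) ⟩
    suc x + windowSum (0 , d) e             ∎)
  ... | no  I⋢J = begin
    count (_⊑? (0 , suc d)) (L ─ I∈L)       ≤⟨ count-─-≤ (_⊑? (0 , suc d)) I∈L ⟩
    count (_⊑? (0 , suc d)) L               ≤⟨ count-mono (_⊑? (0 , suc d)) (_⊑? (1 , suc d))
                                                          (All.tabulate late) ⟩
    count (_⊑? (1 , suc d)) L               ≤⟨ window-≥ hall (1 , suc d) ⟩
    windowSum (0 , d) e                     ≤⟨ ℕP.m≤n+m _ x ⟩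
    x + windowSum (0 , d) e                 ∎
    where
    late : ∀ {J} → J ∈ L → J ⊑ (0 , suc d) → J ⊑ (1 , suc d)
    late {J} J∈L (_ , b≤) with proj₁ J ≟ 0
    ... | yes J-0 = ⊥-elim (I⋢J (z≤n , ℕP.≤-trans (earliest J∈L J-0) b≤))
    ... | no  J≢0 = ℕP.n≢0⇒n>0 J≢0 , b≤

startsAtZero-∈ᵢ : ∀ {m} I (e : Exp (suc m)) → proj₁ I ≡ 0 → 1 ≤ windowSum I e → 0 ∈ᵢ I
startsAtZero-∈ᵢ (zero , suc b) _ refl _  = z≤n , s≤s z≤n
startsAtZero-∈ᵢ (zero , zero)  _ refl ()

mutual
  hall⇒selection : ∀ {m L} {e : Exp m} → Bounded m L → HallCondition L e → Selection L e
  hall⇒selection {L = []}    {e = []}    _       _    = []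
  hall⇒selection {L = I ∷ _} {e = []}    _       hall with () ← hall-occupied {I = I} hall (here refl)
  hall⇒selection             {e = x ∷ e} bounded hall = hall⇒selection-∷ x e bounded hall

  hall⇒selection-∷ : ∀ {m L} x (e : Exp m) → Bounded (suc m) L → HallCondition L (x ∷ e) →
                     Selection L (x ∷ e)
  hall⇒selection-∷ {L = L} zero    e bounded hall =
    selection-unshift L (hall⇒selection (bounded-shift bounded) (hall-shift hall))
  hall⇒selection-∷ {L = L} (suc x) e bounded hall
    with I , (I∈L , I-0) , earliest ← earliestEndingFromZero (hall-someStartsAtZero bounded hall) =
    subst (Selection L) (cong (suc x ∷_) (⊞-identityˡ e))
      (selection-insert I∈L (startsAtZero-∈ᵢ I (suc x ∷ e) I-0 (hall-occupied hall I∈L))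
        (hall⇒selection-∷ x e (AllP.─⁺ I∈L bounded) (hall-─ hall I∈L earliest)))

weightedSum-windowSum : ∀ {m} (ws : List (ℚ × Exp m)) (e : Exp m) →
                        (∀ i → weightedSum ws (λ f → ι (lookup f i)) ≡ ι (lookup e i)) →
                        ∀ J → weightedSum ws (ι ∘ windowSum J) ≡ ι (windowSum J e)
weightedSum-windowSum {zero}  ws e       coords J = weightedSum-zero ws
weightedSum-windowSum {suc m} ws (x ∷ e) coords   = byWindow
  where
  open ≡-Reasoning
  lookup-zero : ∀ (f : Exp (suc m)) → lookup f Fin.zero ≡ head f
  lookup-zero (_ ∷ _) = refl
  lookup-suc : ∀ (f : Exp (suc m)) i → lookup f (Fin.suc i) ≡ lookup (tail f) i
  lookup-suc (_ ∷ _) i = refl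
  heads : weightedSum ws (ι ∘ head) ≡ ι x
  heads = trans (weightedSum-cong ws (λ f → cong ι (sym (lookup-zero f)))) (coords Fin.zero)
  tail-coords : ∀ i → weightedSum (map (Product.map₂ tail) ws) (λ f → ι (lookup f i)) ≡ ι (lookup e i)
  tail-coords i = begin
    weightedSum (map (Product.map₂ tail) ws) (λ f → ι (lookup f i))
      ≡⟨ weightedSum-map₂ ws tail _ ⟩
    weightedSum ws (λ f → ι (lookup (tail f) i))
      ≡⟨ weightedSum-cong ws (λ f → cong ι (lookup-suc f i)) ⟨
    weightedSum ws (λ f → ι (lookup f (Fin.suc i)))
      ≡⟨ coords (Fin.suc i) ⟩
    ι (lookup e i) ∎
  tails : ∀ J → weightedSum ws (ι ∘ windowSum J ∘ tail) ≡ ι (windowSum J e)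
  tails J = trans (sym (weightedSum-map₂ ws tail (ι ∘ windowSum J)))
                  (weightedSum-windowSum (map (Product.map₂ tail) ws) e tail-coords J)
  byWindow : ∀ J → weightedSum ws (ι ∘ windowSum J) ≡ ι (windowSum J (x ∷ e))
  byWindow (zero , zero)  = weightedSum-zero ws
  byWindow (zero , suc d) = begin
    weightedSum ws (λ f → ι (head f + windowSum (0 , d) (tail f)))
      ≡⟨ weightedSum-cong ws (λ f → ι-homo-+ (head f) _) ⟩
    weightedSum ws (λ f → ι (head f) ℚ.+ ι (windowSum (0 , d) (tail f)))
      ≡⟨ weightedSum-+ ws (ι ∘ head) (ι ∘ windowSum (0 , d) ∘ tail) ⟩
    weightedSum ws (ι ∘ head) ℚ.+ weightedSum ws (ι ∘ windowSum (0 , d) ∘ tail)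
      ≡⟨ cong₂ ℚ._+_ heads (tails (0 , d)) ⟩
    ι x ℚ.+ ι (windowSum (0 , d) e)
      ≡⟨ ι-homo-+ x _ ⟨
    ι (x + windowSum (0 , d) e) ∎
  byWindow (suc c , d)    = tails (c , pred d)

hall-convex : ∀ {m L} (ws : List (ℚ × Exp m)) (e : Exp m) →
              All (λ w → 0ℚ ℚ.≤ proj₁ w) ws → sumℚ (map proj₁ ws) ≡ 1ℚ →
              All (HallCondition L ∘ proj₂) ws →
              (∀ i → weightedSum ws (λ f → ι (lookup f i)) ≡ ι (lookup e i)) →
              HallCondition L e
hall-convex {m} {L} ws e nonNeg total halls coords = record
  { total-≤  = ι-cancel-≤ (begin
      ι (windowSum (0 , m) e)                ≡⟨ linear (0 , m) ⟨
      weightedSum ws (ι ∘ windowSum (0 , m))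
        ≤⟨ weightedSum-mono-≤ nonNeg (All.map (ι-mono-≤ ∘ total-≤) halls) ⟩
      weightedSum ws (λ _ → ι (length L))    ≡⟨ weightedSum-const-convex ws _ total ⟩
      ι (length L)                           ∎)
  ; window-≥ = λ J → ι-cancel-≤ (begin
      ι (count (_⊑? J) L)                    ≡⟨ weightedSum-const-convex ws _ total ⟨
      weightedSum ws (λ _ → ι (count (_⊑? J) L))
        ≤⟨ weightedSum-mono-≤ nonNeg (All.map (λ hall → ι-mono-≤ (window-≥ hall J)) halls) ⟩
      weightedSum ws (ι ∘ windowSum J)       ≡⟨ linear J ⟩
      ι (windowSum J e)                      ∎)
  }
  where
  open ℚP.≤-Reasoning
  linear : ∀ J → weightedSum ws (ι ∘ windowSum J) ≡ ι (windowSum J e)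
  linear = weightedSum-windowSum ws e coords

-- Supports of chain weights

exponents : ∀ {n} → Poly n → List (Exp n)
exponents = map proj₂

PositiveCoeffs : ∀ {n} → Poly n → Set
PositiveCoeffs = All (λ t → 0ℚ ℚ.< proj₁ t)

coeff-∉ : ∀ {n} (p : Poly n) {e} → e ∉ exponents p → coeff p e ≡ 0ℚ
coeff-∉ []            _  = refl
coeff-∉ ((c , f) ∷ p) {e} e∉ with VecP.≡-dec ℕP._≟_ f e
... | yes f≡e = ⊥-elim (e∉ (here (sym f≡e)))
... | no  _   = coeff-∉ p (e∉ ∘ there)

coeff-nonNeg : ∀ {n} {p : Poly n} → PositiveCoeffs p → ∀ e → 0ℚ ℚ.≤ coeff p e
coeff-nonNeg                     []          e = ℚP.≤-refl
coeff-nonNeg {p = (c , f) ∷ _} (0<c ∷ pos) e with VecP.≡-dec ℕP._≟_ f e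
... | yes _ = ℚP.+-mono-≤ (ℚP.<⇒≤ 0<c) (coeff-nonNeg pos e)
... | no  _ = coeff-nonNeg pos e

coeff-pos : ∀ {n} {p : Poly n} {e} → PositiveCoeffs p → e ∈ exponents p → 0ℚ ℚ.< coeff p e
coeff-pos {p = (c , f) ∷ _} {e} (0<c ∷ pos) e∈ with VecP.≡-dec ℕP._≟_ f e | e∈
... | yes _   | _          = ℚP.+-mono-<-≤ 0<c (coeff-nonNeg pos e)
... | no  f≢e | here e≡f   = ⊥-elim (f≢e (sym e≡f))
... | no  _   | there e∈′  = coeff-pos pos e∈′

InSupp⇔∈exponents : ∀ {n} {p : Poly n} → PositiveCoeffs p → ∀ e → InSupp p e ⇔ e ∈ exponents p
InSupp⇔∈exponents {p = p} pos e = mk⇔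
  (λ e∈supp → decidable-stable (Any.any? (VecP.≡-dec ℕP._≟_ e) (exponents p)) (e∈supp ∘ coeff-∉ p))
  (λ e∈ coeff≡0 → ℚP.<-irrefl (sym coeff≡0) (coeff-pos pos e∈))

exponents-⊗ : ∀ {n} (p q : Poly n) →
              exponents (p ⊗ q) ≡ cartesianProductWith _⊞_ (exponents p) (exponents q)
exponents-⊗ []            q = refl
exponents-⊗ ((c , f) ∷ p) q = begin
  map proj₂ (map term q ++ p ⊗ q)                ≡⟨ ListP.map-++ proj₂ (map term q) (p ⊗ q) ⟩
  map proj₂ (map term q) ++ exponents (p ⊗ q)    ≡⟨ cong₂ _++_ (trans (sym (ListP.map-∘ q)) (ListP.map-∘ q))
                                                                (exponents-⊗ p q) ⟩
  map (f ⊞_) (exponents q) ++ cartesianProductWith _⊞_ (exponents p) (exponents q) ∎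
  where
  open ≡-Reasoning
  term : ℚ × Exp _ → ℚ × Exp _
  term (d , g) = c ℚ.* d , f ⊞ g

PositiveCoeffs-⊗ : ∀ {n} {p q : Poly n} → PositiveCoeffs p → PositiveCoeffs q → PositiveCoeffs (p ⊗ q)
PositiveCoeffs-⊗ []            _     = []
PositiveCoeffs-⊗ (0<c ∷ pos-p) pos-q =
  AllP.++⁺ (AllP.map⁺ (All.map (pos*pos 0<c) pos-q)) (PositiveCoeffs-⊗ pos-p pos-q)
  where
  pos*pos : ∀ {x y} → 0ℚ ℚ.< x → 0ℚ ℚ.< y → 0ℚ ℚ.< x ℚ.* y
  pos*pos {x} {y} 0<x 0<y =
    ℚP.positive⁻¹ (x ℚ.* y) {{ℚP.pos*pos⇒pos x {{ℚ.positive 0<x}} y {{ℚ.positive 0<y}}}}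

lookup-ext : ∀ {n} {u v : Vec A n} → (∀ j → lookup u j ≡ lookup v j) → u ≡ v
lookup-ext {u = u} {v} u≗v =
  trans (sym (VecP.tabulate∘lookup u)) (trans (VecP.tabulate-cong u≗v) (VecP.tabulate∘lookup v))

exponents-pvar : ∀ {n} (i : Fin n) → exponents (pvar i) ≡ unit i ∷ []
exponents-pvar i = cong (_∷ []) (lookup-ext (coordinates (here refl)))
  where
  -- The exponent of pvar i is built by a local `with` that cannot be named from outside;
  -- going through a membership proof lets unification expose it.
  coordinates : ∀ {e} → e ∈ exponents (pvar i) → ∀ j → lookup e j ≡ lookup (unit i) j
  coordinates (here e≡) j rewrite trans (cong (λ v → lookup v j) e≡) (VecP.lookup∘tabulate _ j)
    with i Fin.≟ j
  ... | yes refl = sym (VecP.lookup∘update i (replicate _ 0) 1)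
  ... | no  i≢j  =
    sym (trans (VecP.lookup∘update′ (i≢j ∘ sym) (replicate _ 0) 1) (VecP.lookup-replicate j 0))

exponents-concatMap-pvar : ∀ {n} (l : List (Fin n)) → exponents (concatMap pvar l) ≡ map unit l
exponents-concatMap-pvar []      = refl
exponents-concatMap-pvar (i ∷ l) = cong₂ _++_ (exponents-pvar i) (exponents-concatMap-pvar l)

PositiveCoeffs-concatMap-pvar : ∀ {n} (l : List (Fin n)) → PositiveCoeffs (concatMap pvar l)
PositiveCoeffs-concatMap-pvar []      = []
PositiveCoeffs-concatMap-pvar (i ∷ l) = ℚP.positive⁻¹ 1ℚ ∷ PositiveCoeffs-concatMap-pvar l

module _ {n : ℕ} (a b : Fin n) where

  edgePositions : List (Fin n)
  edgePositions = filter (λ i → toℕ i ∈ᵢ? (toℕ a , toℕ b)) (allFin n)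

  ∈-edgeWt⁻ : ∀ {e} → e ∈ exponents (edgeWt a b) → ∃ λ i → toℕ i ∈ᵢ (toℕ a , toℕ b) × e ≡ unit i
  ∈-edgeWt⁻ e∈ with ∈P.∈-map⁻ unit (subst (_ ∈_) (exponents-concatMap-pvar edgePositions) e∈)
  ... | i , i∈ , refl = i , proj₂ (∈P.∈-filter⁻ (λ i → toℕ i ∈ᵢ? (toℕ a , toℕ b)) {xs = allFin n} i∈) , refl

  ∈-edgeWt⁺ : ∀ {i} → toℕ i ∈ᵢ (toℕ a , toℕ b) → unit i ∈ exponents (edgeWt a b)
  ∈-edgeWt⁺ {i} i∈ab = subst (_ ∈_) (sym (exponents-concatMap-pvar edgePositions))
    (∈P.∈-map⁺ unit (∈P.∈-filter⁺ (λ i → toℕ i ∈ᵢ? (toℕ a , toℕ b)) (∈P.∈-allFin i) i∈ab))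

module _ {n : ℕ} where

  intervals : ∀ {u w : Perm n} → SatChain u w → List Interval
  intervals ε                       = []
  intervals (cover a b _ _ _ ◅ C) = (toℕ a , toℕ b) ∷ intervals C

  intervals-bounded : ∀ {u w : Perm n} (C : SatChain u w) → Bounded n (intervals C)
  intervals-bounded ε                       = []
  intervals-bounded (cover a b _ _ _ ◅ C) = ℕP.<⇒≤ (FinP.toℕ<n b) ∷ intervals-bounded C

  PositiveCoeffs-chainWt : ∀ {u w : Perm n} (C : SatChain u w) → PositiveCoeffs (chainWt C)
  PositiveCoeffs-chainWt ε                       = ℚP.positive⁻¹ 1ℚ ∷ []
  PositiveCoeffs-chainWt (cover a b _ _ _ ◅ C) =
    PositiveCoeffs-⊗ (PositiveCoeffs-concatMap-pvar (edgePositions a b)) (PositiveCoeffs-chainWt C)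

  ∈-chainWt⁻ : ∀ {u w : Perm n} (C : SatChain u w) {e} →
               e ∈ exponents (chainWt C) → Selection (intervals C) e
  ∈-chainWt⁻ ε                       (here refl) = []
  ∈-chainWt⁻ (cover a b _ _ _ ◅ C) e∈
    with f , g , f∈ , g∈ , refl ←
           ∈P.∈-cartesianProductWith⁻ _⊞_ (exponents (edgeWt a b)) (exponents (chainWt C))
             (subst (_ ∈_) (exponents-⊗ (edgeWt a b) (chainWt C)) e∈)
    with i , i∈ab , refl ← ∈-edgeWt⁻ a b f∈
    = pick i i∈ab (∈-chainWt⁻ C g∈)

  ∈-chainWt⁺ : ∀ {u w : Perm n} (C : SatChain u w) {e} →
               Selection (intervals C) e → e ∈ exponents (chainWt C)
  ∈-chainWt⁺ ε                       []               = here refl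
  ∈-chainWt⁺ (cover a b _ _ _ ◅ C) (pick i i∈ab s) =
    subst (_ ∈_) (sym (exponents-⊗ (edgeWt a b) (chainWt C)))
      (∈P.∈-cartesianProductWith⁺ _⊞_ (∈-edgeWt⁺ a b i∈ab) (∈-chainWt⁺ C s))

  InSupp-chainWt⇔Selection : ∀ {u w : Perm n} (C : SatChain u w) e →
                             InSupp (chainWt C) e ⇔ Selection (intervals C) e
  InSupp-chainWt⇔Selection C e =
    mk⇔ (∈-chainWt⁻ C) (∈-chainWt⁺ C) ⇔-∘ InSupp⇔∈exponents (PositiveCoeffs-chainWt C) e

-- Newton polytopes

toℤ-surjective-nonNeg : ∀ {n} (a : Vec ℤ n) → (∀ i → ∃ λ k → lookup a i ≡ + k) → ∃ λ e → toℤ e ≡ a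
toℤ-surjective-nonNeg a natural = tabulate (proj₁ ∘ natural) , (begin
  Vec.map +_ (tabulate (proj₁ ∘ natural)) ≡⟨ VecP.tabulate-∘ +_ (proj₁ ∘ natural) ⟨
  tabulate (+_ ∘ proj₁ ∘ natural)         ≡⟨ VecP.tabulate-cong (sym ∘ proj₂ ∘ natural) ⟩
  tabulate (lookup a)                     ≡⟨ VecP.tabulate∘lookup a ⟩
  a                                       ∎)
  where open ≡-Reasoning

module _ {n : ℕ} {p : Poly n} where

  InSupp⇒InNewton : ∀ e → InSupp p e → InNewton p (toℤ e)
  InSupp⇒InNewton e e∈supp =
    (1ℚ , e) ∷ [] , (ℚP.<⇒≤ (ℚP.positive⁻¹ 1ℚ) , e∈supp) ∷ [] , ℚP.+-identityʳ 1ℚ ,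
    λ i → trans (ℚP.+-identityʳ _) (trans (ℚP.*-identityˡ _) (cong (_/ 1) (sym (VecP.lookup-map i +_ e))))

  InNewton⇒natural : ∀ {a} → InNewton p a → ∃ λ e → toℤ e ≡ a
  InNewton⇒natural {a} (ws , valid , _ , coords) = toℤ-surjective-nonNeg a natural
    where
    natural : ∀ i → ∃ λ k → lookup a i ≡ + k
    natural i = nonNegative-/1 (lookup a i) (subst (0ℚ ℚ.≤_) (coords i)
      (weightedSum-nonNeg (All.map proj₁ valid)
                          (All.tabulate (λ {w} _ → ι-mono-≤ {k = lookup (proj₂ w) i} z≤n))))

selectionSupport⇒SNP : ∀ {n} (p : Poly n) (L : List Interval) → Bounded n L →
                       (∀ e → InSupp p e ⇔ Selection L e) → SNP p
selectionSupport⇒SNP p L bounded supp⇔sel = InSupp⇒InNewton {p = p} , integerPoint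
  where
  integerPoint : ∀ a → InNewton p a → Σ (Exp _) λ e → (toℤ e ≡ a) × InSupp p e
  integerPoint a newton@(ws , valid , total , coords) with e , refl ← InNewton⇒natural {p = p} {a} newton =
    e , refl , Equivalence.from (supp⇔sel e) (hall⇒selection bounded hall)
    where
    hall : HallCondition L e
    hall = hall-convex ws e (All.map proj₁ valid) total
             (All.map (selection⇒hall ∘ Equivalence.to (supp⇔sel _) ∘ proj₂) valid)
             (λ i → trans (coords i) (cong (_/ 1) (VecP.lookup-map i +_ e)))

proposition3p5 : (n : ℕ) (u w : Perm n) → IsPerm u → IsPerm w →
                 Bruhat u w → SCNP u w → SNP (D u w)
proposition3p5 n u w _ _ _ (C , sameSupp) =
  selectionSupport⇒SNP (D u w) (intervals C) (intervals-bounded C)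
    (λ e → InSupp-chainWt⇔Selection C e ⇔-∘ ⇔-sym (sameSupp e))
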